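{- Let $n\ge 6$ be an integer of the form $n=2^m+1$ with $m$ an integer. Then $$8\ \Big|\ \binom{4n-2}{2n-1}+2\binom{2n-2}{n-1}.$$ -}

-- Write 2^k ∥ x when x is 2^k times an odd number.  The recurrence
-- (N + 1) C(2N + 2, N + 1) = 2 (2N + 1) C(2N, N) gives 2^N ∥ C(2N, N) N! for every N;
-- together with C(2N, N) N! N! = (2N)! this yields 2^N ∥ 2 N! when N is a power of two,
-- and cancelling, 2 ∥ C(2N, N) for such N.  With p = 2^m the recurrence at N = 2p then
-- gives 4 ∥ C(4p + 2, 2p + 1), while 4 ∥ 2 C(2p, p); two numbers that are both four times
-- an odd number add up to a multiple of 8.
module Submission where

open import Data.Nat using (ℕ; _+_; _*_; _∸_; _^_; _≤_)
open import Data.Nat.Divisibility using (_∣_)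
open import Data.Nat.Combinatorics using (_C_)
open import Relation.Binary.PropositionalEquality using (_≡_)

open import Data.Empty using (⊥-elim)
open import Data.Nat.Base using (zero; suc; _!)
open import Data.Nat.Combinatorics using (nCk≡n!/k![n-k]!; k![n∸k]!∣n!)
open import Data.Nat.Divisibility using (divides)
open import Data.Nat.DivMod using (_/_; m/n*n≡m)
open import Data.Nat.Properties
open import Data.Nat.Tactic.RingSolver using (solve-∀)
open import Data.Product using (∃-syntax; _,_)
open import Data.Sum using (_⊎_; inj₁; inj₂)
open import Relation.Binary.PropositionalEquality using (refl; sym; trans; cong; cong₂; subst; subst₂; module ≡-Reasoning)
open ≡-Reasoning

infix 4 2^_∥_

2^_∥_ : ℕ → ℕ → Set
2^ k ∥ x = ∃[ o ] x ≡ 2 ^ k * suc (2 * o)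

central : ℕ → ℕ
central n = (2 * n) C n

even-or-odd : ∀ n → (∃[ q ] n ≡ 2 * q) ⊎ (∃[ q ] n ≡ suc (2 * q))
even-or-odd zero = inj₁ (0 , refl)
even-or-odd (suc n) with even-or-odd n
... | inj₁ (q , refl) = inj₂ (q , refl)
... | inj₂ (q , refl) = inj₁ (suc q , cong suc (sym (+-suc q (q + 0))))

2^0∥odd : ∀ o → 2^ 0 ∥ suc (2 * o)
2^0∥odd o = o , sym (*-identityˡ _)

2^1∥2*odd : ∀ o → 2^ 1 ∥ 2 * suc (2 * o)
2^1∥2*odd o = o , refl

2^1∥2 : 2^ 1 ∥ 2
2^1∥2 = 2^1∥2*odd 0

[1+2o]*[2q]≡2*[[1+2o]*q] : ∀ o q → suc (2 * o) * (2 * q) ≡ 2 * (suc (2 * o) * q)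
[1+2o]*[2q]≡2*[[1+2o]*q] = solve-∀

∥-* : ∀ {a b x y} → 2^ a ∥ x → 2^ b ∥ y → 2^ (a + b) ∥ x * y
∥-* {a} {b} (o , refl) (o′ , refl) = o + o′ + 2 * o * o′ , (begin
  2 ^ a * suc (2 * o) * (2 ^ b * suc (2 * o′))
    ≡⟨ regroup (2 ^ a) (2 ^ b) o o′ ⟩
  2 ^ a * 2 ^ b * suc (2 * (o + o′ + 2 * o * o′))
    ≡⟨ cong (_* suc (2 * (o + o′ + 2 * o * o′))) (^-distribˡ-+-* 2 a b) ⟨
  2 ^ (a + b) * suc (2 * (o + o′ + 2 * o * o′)) ∎)
  where
  regroup : ∀ P Q o o′ → P * suc (2 * o) * (Q * suc (2 * o′))
                       ≡ P * Q * suc (2 * (o + o′ + 2 * o * o′))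
  regroup = solve-∀

odd*y≡2^b*odd⇒2^b∥y : ∀ b {o o′ y} → suc (2 * o) * y ≡ 2 ^ b * suc (2 * o′) → 2^ b ∥ y
odd*y≡2^b*odd⇒2^b∥y zero {o} {o′} {y} eq with even-or-odd y
... | inj₁ (q , refl) = ⊥-elim (even≢odd (suc (2 * o) * q) o′ (begin
  2 * (suc (2 * o) * q) ≡⟨ [1+2o]*[2q]≡2*[[1+2o]*q] o q ⟨
  suc (2 * o) * (2 * q) ≡⟨ eq ⟩
  1 * suc (2 * o′)      ≡⟨ *-identityˡ _ ⟩
  suc (2 * o′)          ∎))
... | inj₂ (q , refl) = 2^0∥odd q
odd*y≡2^b*odd⇒2^b∥y (suc b) {o} {o′} {y} eq with even-or-odd y
... | inj₁ (q , refl) = ∥-* {1} {b} 2^1∥2 (odd*y≡2^b*odd⇒2^b∥y b {o} {o′} {q} (*-cancelˡ-≡ _ _ 2 (begin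
  2 * (suc (2 * o) * q)       ≡⟨ [1+2o]*[2q]≡2*[[1+2o]*q] o q ⟨
  suc (2 * o) * (2 * q)       ≡⟨ eq ⟩
  2 * 2 ^ b * suc (2 * o′)    ≡⟨ *-assoc 2 (2 ^ b) _ ⟩
  2 * (2 ^ b * suc (2 * o′))  ∎)))
... | inj₂ (q , refl) = ⊥-elim (even≢odd (2 ^ b * suc (2 * o′)) (o + q + 2 * o * q) (begin
  2 * (2 ^ b * suc (2 * o′))          ≡⟨ *-assoc 2 (2 ^ b) _ ⟨
  2 * 2 ^ b * suc (2 * o′)            ≡⟨ eq ⟨
  suc (2 * o) * suc (2 * q)           ≡⟨ odd*odd o q ⟩
  suc (2 * (o + q + 2 * o * q))       ∎))
  where
  odd*odd : ∀ o q → suc (2 * o) * suc (2 * q) ≡ suc (2 * (o + q + 2 * o * q))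
  odd*odd = solve-∀

∥-cancelˡ : ∀ {a b x y} → 2^ a ∥ x → 2^ (a + b) ∥ x * y → 2^ b ∥ y
∥-cancelˡ {a} {b} {y = y} (o , refl) (o′ , eq) =
  odd*y≡2^b*odd⇒2^b∥y b {o} {o′} (*-cancelˡ-≡ _ _ (2 ^ a) {{m^n≢0 2 a}} (begin
    2 ^ a * (suc (2 * o) * y)      ≡⟨ *-assoc (2 ^ a) _ y ⟨
    2 ^ a * suc (2 * o) * y        ≡⟨ eq ⟩
    2 ^ (a + b) * suc (2 * o′)     ≡⟨ cong (_* suc (2 * o′)) (^-distribˡ-+-* 2 a b) ⟩
    2 ^ a * 2 ^ b * suc (2 * o′)   ≡⟨ *-assoc (2 ^ a) (2 ^ b) _ ⟩
    2 ^ a * (2 ^ b * suc (2 * o′)) ∎))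

∥-+ : ∀ {k x y} → 2^ k ∥ x → 2^ k ∥ y → 2 ^ suc k ∣ x + y
∥-+ {k} (a , refl) (b , refl) = divides (suc (a + b)) (sum (2 ^ k) a b)
  where
  sum : ∀ P a b → P * suc (2 * a) + P * suc (2 * b) ≡ suc (a + b) * (2 * P)
  sum = solve-∀

nCk*[k!*[n∸k]!]≡n! : ∀ {n k} → k ≤ n → (n C k) * (k ! * (n ∸ k) !) ≡ n !
nCk*[k!*[n∸k]!]≡n! {n} {k} k≤n = begin
  (n C k) * (k ! * (n ∸ k) !)                   ≡⟨ cong (_* (k ! * (n ∸ k) !)) (nCk≡n!/k![n-k]! k≤n) ⟩
  (n ! / (k ! * (n ∸ k) !)) * (k ! * (n ∸ k) !) ≡⟨ m/n*n≡m (k![n∸k]!∣n! k≤n) ⟩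
  n !                                           ∎
  where instance _ = k !* (n ∸ k) !≢0

central*[n!*n!]≡[2n]! : ∀ n → central n * (n ! * n !) ≡ (2 * n) !
central*[n!*n!]≡[2n]! n =
  subst (λ j → central n * (n ! * j !) ≡ (2 * n) !) 2n∸n≡n (nCk*[k!*[n∸k]!]≡n! (m≤m+n n (n + 0)))
  where
  2n∸n≡n : 2 * n ∸ n ≡ n
  2n∸n≡n = trans (m+n∸m≡n n (n + 0)) (+-identityʳ n)

[1+n]*central[1+n]≡2[1+2n]*central[n] : ∀ n → suc n * central (suc n) ≡ 2 * suc (2 * n) * central n
[1+n]*central[1+n]≡2[1+2n]*central[n] n =
  *-cancelʳ-≡ _ _ (suc n * (n ! * n !)) {{m*n≢0 (suc n) _ {{_}} {{n !* n !≢0}}}} (begin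
  suc n * central (suc n) * (suc n * (n ! * n !))       ≡⟨ squares (central (suc n)) n (n !) ⟩
  central (suc n) * (suc n ! * suc n !)                 ≡⟨ central*[n!*n!]≡[2n]! (suc n) ⟩
  (2 * suc n) !                                         ≡⟨ cong _! (*-suc 2 n) ⟩
  (2 + 2 * n) * ((1 + 2 * n) * (2 * n) !)
    ≡⟨ cong (λ f → (2 + 2 * n) * ((1 + 2 * n) * f)) (central*[n!*n!]≡[2n]! n) ⟨
  (2 + 2 * n) * ((1 + 2 * n) * (central n * (n ! * n !))) ≡⟨ factor (central n) n (n !) ⟩
  2 * suc (2 * n) * central n * (suc n * (n ! * n !))   ∎)
  where
  squares : ∀ X n F → suc n * X * (suc n * (F * F)) ≡ X * ((suc n * F) * (suc n * F))
  squares = solve-∀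
  factor : ∀ X n F → (2 + 2 * n) * ((1 + 2 * n) * (X * (F * F)))
                   ≡ 2 * suc (2 * n) * X * (suc n * (F * F))
  factor = solve-∀

2^n∥central[n]*n! : ∀ n → 2^ n ∥ central n * n !
2^n∥central[n]*n! zero = 0 , refl
2^n∥central[n]*n! (suc n) = subst (2^ suc n ∥_) reorder (∥-* {1} {n} (2^1∥2*odd n) (2^n∥central[n]*n! n))
  where
  reorder : 2 * suc (2 * n) * (central n * n !) ≡ central (suc n) * suc n !
  reorder = begin
    2 * suc (2 * n) * (central n * n !)   ≡⟨ *-assoc (2 * suc (2 * n)) (central n) (n !) ⟨
    2 * suc (2 * n) * central n * n !     ≡⟨ cong (_* n !) ([1+n]*central[1+n]≡2[1+2n]*central[n] n) ⟨
    suc n * central (suc n) * n !         ≡⟨ cong (_* n !) (*-comm (suc n) (central (suc n))) ⟩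
    central (suc n) * suc n * n !         ≡⟨ *-assoc (central (suc n)) (suc n) (n !) ⟩
    central (suc n) * suc n !             ∎

2^[2^k]∥2*[2^k]! : ∀ k → 2^ (2 ^ k) ∥ 2 * (2 ^ k) !
2^[2^k]∥2*[2^k]! zero = 0 , refl
2^[2^k]∥2*[2^k]! (suc k) =
  subst₂ 2^_∥_ (cong (N +_) (sym (+-identityʳ N))) reorder (∥-* {N} {N} (2^[2^k]∥2*[2^k]! k) (2^n∥central[n]*n! N))
  where
  N = 2 ^ k
  reorder : 2 * N ! * (central N * N !) ≡ 2 * (2 * N) !
  reorder = begin
    2 * N ! * (central N * N !)   ≡⟨ rearrange (N !) (central N) ⟩
    2 * (central N * (N ! * N !)) ≡⟨ cong (2 *_) (central*[n!*n!]≡[2n]! N) ⟩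
    2 * (2 * N) !                 ∎
    where
    rearrange : ∀ F X → 2 * F * (X * F) ≡ 2 * (X * (F * F))
    rearrange = solve-∀

2^1∥central[2^k] : ∀ k → 2^ 1 ∥ central (2 ^ k)
2^1∥central[2^k] k = ∥-cancelˡ {N} {1} (2^[2^k]∥2*[2^k]! k)
  (subst₂ 2^_∥_ (+-comm 1 N) reorder (∥-* {1} {N} 2^1∥2 (2^n∥central[n]*n! N)))
  where
  N = 2 ^ k
  reorder : 2 * (central N * N !) ≡ 2 * N ! * central N
  reorder = rearrange (central N) (N !)
    where
    rearrange : ∀ X F → 2 * (X * F) ≡ 2 * F * X
    rearrange = solve-∀

2^2∥central[1+2^[k+1]] : ∀ k → 2^ 2 ∥ central (suc (2 * 2 ^ k))
2^2∥central[1+2^[k+1]] k = ∥-cancelˡ {0} {2} (2^0∥odd (2 ^ k))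
  (subst (2^ 2 ∥_) (sym ([1+n]*central[1+n]≡2[1+2n]*central[n] (2 * 2 ^ k)))
    (∥-* {1} {1} (2^1∥2*odd (2 * 2 ^ k)) (2^1∥central[2^k] (suc k))))

8∣central[1+2^[k+1]]+2*central[2^k] : ∀ k → 8 ∣ central (suc (2 * 2 ^ k)) + 2 * central (2 ^ k)
8∣central[1+2^[k+1]]+2*central[2^k] k =
  ∥-+ {2} (2^2∥central[1+2^[k+1]] k) (∥-* {1} {1} 2^1∥2 (2^1∥central[2^k] k))

-- The congruence holds for every m.
lemma2p4 : (n m : ℕ) → 6 ≤ n → n ≡ 2 ^ m + 1 →
    8 ∣ (((4 * n ∸ 2) C (2 * n ∸ 1)) + 2 * ((2 * n ∸ 2) C (n ∸ 1)))
lemma2p4 .(2 ^ m + 1) m _ refl =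
  subst (8 ∣_) (cong₂ (λ c c′ → c + 2 * c′) (cong₂ _C_ 2[1+2p]≡4[p+1]∸2 1+2p≡2p≡p+1∸1) (cong₂ _C_ 2p≡2[p+1]∸2 p≡p+1∸1))
    (8∣central[1+2^[k+1]]+2*central[2^k] m)
  where
  p = 2 ^ m
  2[1+2p]≡4[p+1]∸2 : 2 * suc (2 * p) ≡ 4 * (p + 1) ∸ 2
  2[1+2p]≡4[p+1]∸2 = cong (_∸ 2) (identity p)
    where
    identity : ∀ p → 2 + 2 * suc (2 * p) ≡ 4 * (p + 1)
    identity = solve-∀
  1+2p≡2p≡p+1∸1 : suc (2 * p) ≡ 2 * (p + 1) ∸ 1
  1+2p≡2p≡p+1∸1 = cong (_∸ 1) (identity p)
    where
    identity : ∀ p → 1 + suc (2 * p) ≡ 2 * (p + 1)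
    identity = solve-∀
  2p≡2[p+1]∸2 : 2 * p ≡ 2 * (p + 1) ∸ 2
  2p≡2[p+1]∸2 = cong (_∸ 2) (identity p)
    where
    identity : ∀ p → 2 + 2 * p ≡ 2 * (p + 1)
    identity = solve-∀
  p≡p+1∸1 : p ≡ p + 1 ∸ 1
  p≡p+1∸1 = sym (m+n∸n≡m p 1)
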